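{- Let $v_1,\dots,v_n$ be a matching ordering of a tournament $G$. If $v$ is a vertex of $G$ with indegree $b$, then $v$ is one of $v_b$, $v_{b+1}$, $v_{b+2}$. Moreover, $v=v_b$ if and only if $v$ is the head of a backedge, $v=v_{b+2}$ if and only if $v$ is the tail of a backedge, and $v=v_{b+1}$ if and only if $v$ is not an end of any backedge.
   Context: A tournament has exactly one directed edge between any two distinct vertices. Given an ordering $v_1,\dots,v_n$ of $V(G)$, a backedge is an edge $v_j\to v_i$ with $j>i$ (its tail is $v_j$, its head is $v_i$). A matching ordering is an ordering in which every vertex is the head or tail of at most one backedge. -}

module Defs where

open import Data.Nat using (ℕ; suc; _+_; _<_)
open import Data.Fin using (Fin; toℕ)
open import Data.Bool using (Bool; true; false; T; not)
open import Data.List using (List; length; filter)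
open import Data.List using () renaming (allFin to allFinL)
open import Data.Product using (Σ; _×_; ∃-syntax)
open import Data.Empty using (⊥)
open import Relation.Nullary using (¬_)
open import Relation.Binary.PropositionalEquality using (_≡_; _≢_)
open import Function.Bundles using (_↔_; Inverse)
open import Data.Bool.Properties using (T?)

-- A digraph on vertex set Fin n, given by a Boolean adjacency: adj u v ≡ true
-- means there is an edge u → v.
Digraph : ℕ → Set
Digraph n = Fin n → Fin n → Bool

record IsTournament {n : ℕ} (G : Digraph n) : Set where
  field
    irrefl : ∀ u → G u u ≡ false
    exactlyOne : ∀ u v → u ≢ v → G u v ≡ not (G v u)

indegree : ∀ {n} → Digraph n → Fin n → ℕ
indegree {n} G v = length (filter (λ u → T? (G u v)) (allFinL n))

-- An ordering v_1, …, v_n of V(G): a bijection from positions to vertices.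
-- Position p : Fin n (0-based) corresponds to index toℕ p + 1 (1-based).
Ordering : ℕ → Set
Ordering n = Fin n ↔ Fin n

module _ {n : ℕ} (G : Digraph n) (σ : Ordering n) where
  open Inverse σ renaming (to to vert; from to pos)

  Backedge : Fin n → Fin n → Set
  Backedge t h = T (G t h) × toℕ (pos h) < toℕ (pos t)

  IsHead : Fin n → Set
  IsHead v = ∃[ t ] Backedge t v

  IsTail : Fin n → Set
  IsTail v = ∃[ h ] Backedge v h

  AtMostOneBackedge : Fin n → Set
  AtMostOneBackedge v =
    (∀ a b → (Backedge v a ⊎' Backedge a v) → (Backedge v b ⊎' Backedge b v) → a ≡ b)
    where
      open import Data.Sum using () renaming (_⊎_ to _⊎'_)

  IsMatchingOrdering : Set
  IsMatchingOrdering = ∀ v → AtMostOneBackedge v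

  index : Fin n → ℕ
  index v = suc (toℕ (pos v))

-- For a vertex u ≠ v, compare the edge between u and v with their order. If u precedes v,
-- the edge either enters v or is a backedge with tail v, but not both; if u follows v, the
-- edge enters v iff it is a backedge with head v. Summing over u,
--   indegree v + #(backedges with tail v) = #(vertices before v) + #(backedges with head v),
-- and in a matching ordering each backedge count is 0 or 1, and they are not both 1.
module Submission where

open import Defs
open import Data.Nat using (ℕ; suc; _+_)
open import Data.Fin using (Fin)
open import Data.Sum using (_⊎_)
open import Data.Product using (_×_)
open import Relation.Nullary using (¬_)
open import Relation.Binary.PropositionalEquality using (_≡_)
open import Function.Bundles using (_⇔_)

open import Data.Nat as ℕ using (zero; z<s; s<s; s<s⁻¹)
open import Data.Nat.Properties
  using (+-0-commutativeMonoid; +-identityʳ; +-comm; +-suc; +-cancelˡ-≡; m<m+n; <⇒≢; suc-injective)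
open import Data.Fin using (zero; suc; toℕ; punchIn)
open import Data.Fin.Properties using (_<?_; <-cmp; <-irrefl; <-asym; any?; punchInᵢ≢i)
import Data.Fin.Permutation as Permutation
open import Algebra.Properties.CommutativeMonoid.Sum +-0-commutativeMonoid
  using (sum; sum-cong-≗; sum-remove; sum-permute; ∑-distrib-+)
open import Data.Bool using (true; false; T; not)
open import Data.Bool.Properties using (T?)
open import Data.List using (length; filter; tabulate)
open import Data.Product using (_,_; proj₁; proj₂)
open import Data.Sum using (inj₁; inj₂)
open import Data.Unit using (tt)
open import Function using (_∘_; mk⇔; Injection; Inverse; Equivalence)
open import Function.Properties.Inverse using (↔⇒↣)
open import Relation.Binary.Definitions using (tri<; tri≈; tri>)
open import Relation.Binary.PropositionalEquality using (_≢_; refl; sym; trans; cong; cong₂; subst; module ≡-Reasoning)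
open import Relation.Nullary using (Dec; yes; no; _×-dec_; contradiction)
open import Level using (Level; _⊔_)
open import Relation.Unary using (Pred; Decidable)

private
  variable
    a a′ ℓ : Level
    A : Set a
    B : Set a′

indicator : Dec A → ℕ
indicator (yes _) = 1
indicator (no _)  = 0

indicator-yes : A → (A? : Dec A) → indicator A? ≡ 1
indicator-yes x (yes _) = refl
indicator-yes x (no ¬x) = contradiction x ¬x

indicator-no : ¬ A → (A? : Dec A) → indicator A? ≡ 0
indicator-no ¬x (yes x) = contradiction x ¬x
indicator-no ¬x (no _)  = refl

indicator-cong : (A → B) → (B → A) → (A? : Dec A) (B? : Dec B) → indicator A? ≡ indicator B?
indicator-cong f g (yes x) B? = sym (indicator-yes (f x) B?)
indicator-cong f g (no ¬x) B? = sym (indicator-no (¬x ∘ g) B?)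

indicator-complement : (B → ¬ A) → (¬ A → B) → (A? : Dec A) (B? : Dec B) →
                       indicator A? + indicator B? ≡ 1
indicator-complement f g (yes x) B? = cong suc (indicator-no (λ y → f y x) B?)
indicator-complement f g (no ¬x) B? = indicator-yes (g ¬x) B?

T-not⇔¬T : ∀ x → T (not x) ⇔ (¬ T x)
T-not⇔¬T true  = mk⇔ (λ ()) (λ ¬t → ¬t tt)
T-not⇔¬T false = mk⇔ (λ _ ()) (λ _ → tt)

count : ∀ {n} {P : Pred (Fin n) ℓ} → Decidable P → ℕ
count P? = sum (indicator ∘ P?)

length-filter-tabulate : ∀ {n} {P : Pred A ℓ} (P? : Decidable P) (f : Fin n → A) →
                         length (filter P? (tabulate f)) ≡ sum (indicator ∘ P? ∘ f)
length-filter-tabulate {n = zero}  P? f = refl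
length-filter-tabulate {n = suc n} P? f with P? (f zero)
... | yes _ = cong suc (length-filter-tabulate P? (f ∘ suc))
... | no _  = length-filter-tabulate P? (f ∘ suc)

count-none : ∀ {n} {P : Pred (Fin n) ℓ} (P? : Decidable P) → (∀ i → ¬ P i) → count P? ≡ 0
count-none {n = zero}  P? none = refl
count-none {n = suc n} P? none =
  cong₂ _+_ (indicator-no (none zero) (P? zero)) (count-none (P? ∘ suc) (none ∘ suc))

count-unique : ∀ {n} {P : Pred (Fin n) ℓ} (P? : Decidable P) →
               (∀ i j → P i → P j → i ≡ j) → ∀ {i} → P i → count P? ≡ 1
count-unique {n = suc n} {P = P} P? unique {i} pᵢ = begin
  count P?                                        ≡⟨ sum-remove {i = i} (indicator ∘ P?) ⟩
  indicator (P? i) + count (P? ∘ punchIn i)       ≡⟨ cong₂ _+_ (indicator-yes pᵢ (P? i)) (count-none (P? ∘ punchIn i) others) ⟩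
  1                                               ∎
  where
  open ≡-Reasoning
  others : ∀ j → ¬ P (punchIn i j)
  others j pⱼ = punchInᵢ≢i i j (unique _ _ pⱼ pᵢ)

count-at-most-one : ∀ {n} {P : Pred (Fin n) ℓ} (P? : Decidable P) →
                    (∀ i j → P i → P j → i ≡ j) → count P? ≡ indicator (any? P?)
count-at-most-one P? unique with any? P?
... | yes (i , pᵢ) = count-unique P? unique pᵢ
... | no ∄        = count-none P? (λ i pᵢ → ∄ (i , pᵢ))

count-< : ∀ {n} (j : Fin n) → count (λ (i : Fin n) → i <? j) ≡ toℕ j
count-< {n = suc n} j@zero  = count-none (λ (i : Fin (suc n)) → i <? j) (λ _ ())
count-< {n = suc n} (suc j) = cong₂ _+_ (indicator-yes z<s (zero {n} <? suc j)) (begin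
  count (λ (i : Fin n) → suc i <? suc j)  ≡⟨ sum-cong-≗ {n = n} (λ i → indicator-cong s<s⁻¹ s<s (suc i <? suc j) (i <? j)) ⟩
  count (λ (i : Fin n) → i <? j)          ≡⟨ count-< j ⟩
  toℕ j                                   ∎)
  where open ≡-Reasoning

IndexDeterminedByRole : ℕ → ℕ → Set a → Set a′ → Set (a ⊔ a′)
IndexDeterminedByRole i b Head Tail =
  ((i ≡ b) ⊎ (i ≡ b + 1) ⊎ (i ≡ b + 2))
  × ((i ≡ b) ⇔ Head)
  × ((i ≡ b + 2) ⇔ Tail)
  × ((i ≡ b + 1) ⇔ (¬ Head × ¬ Tail))

m≢m+suc : ∀ m k → m ≢ m + suc k
m≢m+suc m k = <⇒≢ (m<m+n m z<s)

m+1≢m+2 : ∀ m → m + 1 ≢ m + 2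
m+1≢m+2 m = (λ ()) ∘ +-cancelˡ-≡ m 1 2

module _ {i b : ℕ} {Head : Set a} {Tail : Set a′} where
  head-index : i ≡ b → Head → ¬ Tail → IndexDeterminedByRole i b Head Tail
  head-index refl h ¬t = inj₁ refl
    , mk⇔ (λ _ → h) (λ _ → refl)
    , mk⇔ (λ e → contradiction e (m≢m+suc b 1)) (λ t → contradiction t ¬t)
    , mk⇔ (λ e → contradiction e (m≢m+suc b 0)) (λ (¬h , _) → contradiction h ¬h)

  tail-index : i ≡ b + 2 → ¬ Head → Tail → IndexDeterminedByRole i b Head Tail
  tail-index refl ¬h t = inj₂ (inj₂ refl)
    , mk⇔ (λ e → contradiction (sym e) (m≢m+suc b 1)) (λ h → contradiction h ¬h)
    , mk⇔ (λ _ → t) (λ _ → refl)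
    , mk⇔ (λ e → contradiction (sym e) (m+1≢m+2 b)) (λ (_ , ¬t) → contradiction t ¬t)

  neither-index : i ≡ b + 1 → ¬ Head → ¬ Tail → IndexDeterminedByRole i b Head Tail
  neither-index refl ¬h ¬t = inj₂ (inj₁ refl)
    , mk⇔ (λ e → contradiction (sym e) (m≢m+suc b 0)) (λ h → contradiction h ¬h)
    , mk⇔ (λ e → contradiction e (m+1≢m+2 b)) (λ t → contradiction t ¬t)
    , mk⇔ (λ _ → ¬h , ¬t) (λ _ → refl)

  -- The balance is stated in this shape so that each case yields i ≡ b + k with at most one rewrite.
  index-determined-by-role : (Head? : Dec Head) (Tail? : Dec Tail) → ¬ (Head × Tail) →
                             indicator Head? + i ≡ b + (1 + indicator Tail?) →
                             IndexDeterminedByRole i b Head Tail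
  index-determined-by-role (yes h) (yes t) ¬both _ = contradiction (h , t) ¬both
  index-determined-by-role (yes h) (no ¬t) _ e = head-index (suc-injective (trans e (+-comm b 1))) h ¬t
  index-determined-by-role (no ¬h) (yes t) _ e = tail-index e ¬h t
  index-determined-by-role (no ¬h) (no ¬t) _ e = neither-index e ¬h ¬t

module _ {n : ℕ} (G : Digraph n) (σ : Ordering n) where
  open Inverse σ using () renaming (from to pos)

  pos-injective : ∀ {u v} → pos u ≡ pos v → u ≡ v
  pos-injective = Injection.injective (↔⇒↣ (Permutation.flip σ))

  backedge? : ∀ t h → Dec (Backedge G σ t h)
  backedge? t h = T? (G t h) ×-dec (pos h <? pos t)

  isHead? : ∀ v → Dec (IsHead G σ v)
  isHead? v = any? (λ t → backedge? t v)

  isTail? : ∀ v → Dec (IsTail G σ v)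
  isTail? v = any? (backedge? v)

  count-before : ∀ v → count (λ u → pos u <? pos v) ≡ toℕ (pos v)
  count-before v = trans (sym (sum-permute (λ i → indicator (i <? pos v)) (Permutation.flip σ))) (count-< (pos v))

  module _ (tournament : IsTournament G) where
    open IsTournament tournament

    edge-reversed : ∀ {u v} → u ≢ v → T (G v u) ⇔ (¬ T (G u v))
    edge-reversed {u} {v} u≢v rewrite exactlyOne v u (u≢v ∘ sym) = T-not⇔¬T (G u v)

    edge-balance-self : ∀ v → indicator (T? (G v v)) ≡ indicator (pos v <? pos v)
    edge-balance-self v = trans (indicator-no (subst T (irrefl v)) (T? (G v v)))
                                (sym (indicator-no (<-irrefl refl) (pos v <? pos v)))

    edge-balance : ∀ u v → indicator (T? (G u v)) + indicator (backedge? v u)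
                         ≡ indicator (pos u <? pos v) + indicator (backedge? u v)
    edge-balance u v with <-cmp (pos u) (pos v)
    ... | tri≈ _ pu≡pv _ with refl ← pos-injective pu≡pv =
      cong (_+ indicator (backedge? u u)) (edge-balance-self u)
    ... | tri< pu<pv pu≢pv _ = begin
      indicator (T? (G u v)) + indicator (backedge? v u)   ≡⟨ indicator-complement forward backward (T? (G u v)) (backedge? v u) ⟩
      1                                                     ≡⟨ cong₂ _+_ (indicator-yes pu<pv (pos u <? pos v)) (indicator-no (<-asym pu<pv ∘ proj₂) (backedge? u v)) ⟨
      indicator (pos u <? pos v) + indicator (backedge? u v) ∎
      where
      open ≡-Reasoning
      u≢v : u ≢ v
      u≢v = pu≢pv ∘ cong pos
      forward : Backedge G σ v u → ¬ T (G u v)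
      forward = Equivalence.to (edge-reversed u≢v) ∘ proj₁
      backward : ¬ T (G u v) → Backedge G σ v u
      backward ¬e = Equivalence.from (edge-reversed u≢v) ¬e , pu<pv
    ... | tri> _ _ pv<pu = begin
      indicator (T? (G u v)) + indicator (backedge? v u)   ≡⟨ cong (indicator (T? (G u v)) +_) (indicator-no (<-asym pv<pu ∘ proj₂) (backedge? v u)) ⟩
      indicator (T? (G u v)) + 0                            ≡⟨ +-identityʳ _ ⟩
      indicator (T? (G u v))                                ≡⟨ indicator-cong (_, pv<pu) proj₁ (T? (G u v)) (backedge? u v) ⟩
      indicator (backedge? u v)                             ≡⟨ cong (_+ indicator (backedge? u v)) (indicator-no (<-asym pv<pu) (pos u <? pos v)) ⟨
      indicator (pos u <? pos v) + indicator (backedge? u v) ∎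
      where open ≡-Reasoning

    indegree-balance : ∀ v → indegree G v + count (backedge? v) ≡ toℕ (pos v) + count (λ t → backedge? t v)
    indegree-balance v = begin
      indegree G v + count (backedge? v)
        ≡⟨ cong (_+ count (backedge? v)) (length-filter-tabulate (λ u → T? (G u v)) (λ u → u)) ⟩
      count (λ u → T? (G u v)) + count (backedge? v)
        ≡⟨ ∑-distrib-+ (indicator ∘ λ u → T? (G u v)) (indicator ∘ backedge? v) ⟨
      sum (λ u → indicator (T? (G u v)) + indicator (backedge? v u))
        ≡⟨ sum-cong-≗ (λ u → edge-balance u v) ⟩
      sum (λ u → indicator (pos u <? pos v) + indicator (backedge? u v))
        ≡⟨ ∑-distrib-+ (λ u → indicator (pos u <? pos v)) (λ u → indicator (backedge? u v)) ⟩
      count (λ u → pos u <? pos v) + count (λ t → backedge? t v)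
        ≡⟨ cong (_+ count (λ t → backedge? t v)) (count-before v) ⟩
      toℕ (pos v) + count (λ t → backedge? t v) ∎
      where open ≡-Reasoning

  module _ (matching : IsMatchingOrdering G σ) (v : Fin n) where
    heads-unique : ∀ s t → Backedge G σ s v → Backedge G σ t v → s ≡ t
    heads-unique s t bs bt = matching v s t (inj₂ bs) (inj₂ bt)

    tails-unique : ∀ s t → Backedge G σ v s → Backedge G σ v t → s ≡ t
    tails-unique s t bs bt = matching v s t (inj₁ bs) (inj₁ bt)

    not-head-and-tail : ¬ (IsHead G σ v × IsTail G σ v)
    not-head-and-tail ((t , bt) , (h , bh)) with refl ← matching v t h (inj₂ bt) (inj₁ bh) =
      <-asym (proj₂ bt) (proj₂ bh)

    index-balance : IsTournament G →
                    indicator (isHead? v) + index G σ v ≡ indegree G v + (1 + indicator (isTail? v))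
    index-balance tournament = begin
      indicator (isHead? v) + suc (toℕ (pos v))          ≡⟨ +-suc _ _ ⟩
      suc (indicator (isHead? v) + toℕ (pos v))          ≡⟨ cong ℕ.suc (+-comm (indicator (isHead? v)) (toℕ (pos v))) ⟩
      suc (toℕ (pos v) + indicator (isHead? v))          ≡⟨ cong (ℕ.suc ∘ (toℕ (pos v) +_)) (count-at-most-one (λ t → backedge? t v) heads-unique) ⟨
      suc (toℕ (pos v) + count (λ t → backedge? t v))    ≡⟨ cong ℕ.suc (indegree-balance tournament v) ⟨
      suc (indegree G v + count (backedge? v))           ≡⟨ cong (ℕ.suc ∘ (indegree G v +_)) (count-at-most-one (backedge? v) tails-unique) ⟩
      suc (indegree G v + indicator (isTail? v))         ≡⟨ +-suc _ _ ⟨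
      indegree G v + (1 + indicator (isTail? v))         ∎
      where open ≡-Reasoning

proposition5p1 : ∀ (n : ℕ) (G : Digraph n) (σ : Ordering n) →
    IsTournament G → IsMatchingOrdering G σ →
    ∀ (v : Fin n) (b : ℕ) → indegree G v ≡ b →
    ((index G σ v ≡ b) ⊎ (index G σ v ≡ b + 1) ⊎ (index G σ v ≡ b + 2))
    × ((index G σ v ≡ b) ⇔ IsHead G σ v)
    × ((index G σ v ≡ b + 2) ⇔ IsTail G σ v)
    × ((index G σ v ≡ b + 1) ⇔ (¬ IsHead G σ v × ¬ IsTail G σ v))
proposition5p1 n G σ tournament matching v b refl =
  index-determined-by-role (isHead? G σ v) (isTail? G σ v)
    (not-head-and-tail G σ matching v) (index-balance G σ matching v tournament)
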